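{- Every proof of a sequent in $\mathcal{G}$ can be reduced to a W-normal proof of the same sequent having the same degree.
   Context: Formulae are built from propositional variables and $\bot$ with the binary connectives $\wedge,\vee,\rightarrow$. Sequents have the form $\Gamma \vdash C$, $\Gamma$ a finite (possibly empty) sequence of formulae, $C$ a formula. The system $\mathcal{G}$ (for intuitionistic propositional logic) has axioms $A \vdash A$ and $\bot \vdash A$ and rules: (C) from $\Delta, A, B, \Gamma \vdash C$ infer $\Delta, B, A, \Gamma \vdash C$; (W) from $\Theta, A, A, \Gamma \vdash C$ infer $\Theta, A, \Gamma \vdash C$; (K) from $\Theta, \Gamma \vdash C$ infer $\Theta, A, \Gamma \vdash C$; (cut) from $\Delta \vdash A$ and $\Theta, A, \Gamma \vdash C$ infer $\Theta, \Delta, \Gamma \vdash C$ ($A$ is the cut formula); ($\wedge$L) from $\Theta, A, \Gamma \vdash C$ (resp. $\Theta, B, \Gamma \vdash C$) infer $\Theta, A\wedge B, \Gamma \vdash C$; ($\wedge$R) from $\Gamma \vdash A$ and $\Gamma \vdash B$ infer $\Gamma \vdash A \wedge B$; ($\vee$L) from $\Theta, A, \Gamma \vdash C$ and $\Theta, B, \Gamma \vdash C$ infer $\Theta, A \vee B, \Gamma \vdash C$; ($\vee$R) from $\Gamma \vdash A$ (resp. $\Gamma \vdash B$) infer $\Gamma \vdash A \vee B$; ($\rightarrow$L) from $\Delta \vdash A$ and $\Theta, B, \Gamma \vdash C$ infer $\Theta, \Delta, A \rightarrow B, \Gamma \vdash C$; ($\rightarrow$R) from $A, \Gamma \vdash B$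 infer $\Gamma \vdash A \rightarrow B$. The degree of a cut is the number of binary connectives in its cut formula; the degree of a proof is the maximal degree of its cuts (0 if none). A proof is W-normal iff every application of (W) in it either is the last rule of the proof, or has only applications of (W) below it, or is the upper rule in one of the two contexts: (i) $\Theta, A, A, A, \Gamma \vdash C$ by (W) to $\Theta, A, A, \Gamma \vdash C$ followed by (W) to $\Theta, A, \Gamma \vdash C$; (ii) $A, A, \Gamma \vdash B$ by (W) to $A, \Gamma \vdash B$ followed by ($\rightarrow$R) to $\Gamma \vdash A \rightarrow B$. -}

module Defs where

open import Data.Nat using (ℕ; zero; suc; _+_; _⊔_)
open import Data.List using (List; []; _∷_; _++_; [_])
open import Data.Product using (Σ; _×_; _,_; ∃-syntax)
open import Data.Sum using (_⊎_)
open import Data.Unit using (⊤)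
open import Data.Empty using (⊥)
open import Relation.Binary.PropositionalEquality using (_≡_)

infixr 6 _∧_
infixr 5 _∨_
infixr 4 _⇒_

data Formula : Set where
  var : ℕ → Formula
  ⊥̇   : Formula
  _∧_ : Formula → Formula → Formula
  _∨_ : Formula → Formula → Formula
  _⇒_ : Formula → Formula → Formula

size : Formula → ℕ
size (var _) = 0
size ⊥̇ = 0
size (A ∧ B) = suc (size A + size B)
size (A ∨ B) = suc (size A + size B)
size (A ⇒ B) = suc (size A + size B)

Ctx : Set
Ctx = List Formula

infix 2 _⊢_

data _⊢_ : Ctx → Formula → Set where
  ax   : ∀ A → [ A ] ⊢ A
  ax⊥  : ∀ A → [ ⊥̇ ] ⊢ A
  C    : ∀ Δ A B Γ {D} → (Δ ++ A ∷ B ∷ Γ) ⊢ D → (Δ ++ B ∷ A ∷ Γ) ⊢ D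
  W    : ∀ Θ A Γ {D} → (Θ ++ A ∷ A ∷ Γ) ⊢ D → (Θ ++ A ∷ Γ) ⊢ D
  K    : ∀ Θ A Γ {D} → (Θ ++ Γ) ⊢ D → (Θ ++ A ∷ Γ) ⊢ D
  cut  : ∀ Δ Θ A Γ {D} → Δ ⊢ A → (Θ ++ A ∷ Γ) ⊢ D → (Θ ++ Δ ++ Γ) ⊢ D
  ∧L₁  : ∀ Θ A B Γ {D} → (Θ ++ A ∷ Γ) ⊢ D → (Θ ++ (A ∧ B) ∷ Γ) ⊢ D
  ∧L₂  : ∀ Θ A B Γ {D} → (Θ ++ B ∷ Γ) ⊢ D → (Θ ++ (A ∧ B) ∷ Γ) ⊢ D
  ∧R   : ∀ Γ A B → Γ ⊢ A → Γ ⊢ B → Γ ⊢ A ∧ B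
  ∨L   : ∀ Θ A B Γ {D} → (Θ ++ A ∷ Γ) ⊢ D → (Θ ++ B ∷ Γ) ⊢ D → (Θ ++ (A ∨ B) ∷ Γ) ⊢ D
  ∨R₁  : ∀ Γ A B → Γ ⊢ A → Γ ⊢ A ∨ B
  ∨R₂  : ∀ Γ A B → Γ ⊢ B → Γ ⊢ A ∨ B
  ⇒L   : ∀ Δ Θ A B Γ {D} → Δ ⊢ A → (Θ ++ B ∷ Γ) ⊢ D → (Θ ++ Δ ++ (A ⇒ B) ∷ Γ) ⊢ D
  ⇒R   : ∀ A Γ B → (A ∷ Γ) ⊢ B → Γ ⊢ A ⇒ B

degree : ∀ {Γ D} → Γ ⊢ D → ℕ
degree (ax _) = 0
degree (ax⊥ _) = 0
degree (C _ _ _ _ p) = degree p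
degree (W _ _ _ p) = degree p
degree (K _ _ _ p) = degree p
degree (cut _ _ A _ p q) = size A ⊔ (degree p ⊔ degree q)
degree (∧L₁ _ _ _ _ p) = degree p
degree (∧L₂ _ _ _ _ p) = degree p
degree (∧R _ _ _ p q) = degree p ⊔ degree q
degree (∨L _ _ _ _ p q) = degree p ⊔ degree q
degree (∨R₁ _ _ _ p) = degree p
degree (∨R₂ _ _ _ p) = degree p
degree (⇒L _ _ _ _ _ p q) = degree p ⊔ degree q
degree (⇒R _ _ _ p) = degree p

-- What lies below a node of a proof tree (the path to the root, as far as needed).
data Below : Set where
  root    : Below                       -- the node is the last rule of the proof
  underW  : Below → Ctx → Below         -- immediately below is a (W) with this conclusion antecedent
  under⇒R : Formula → Ctx → Below       -- immediately below is a (⇒R) concluding Γ ⊢ A → B (A, Γ)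
  underO  : Below                       -- immediately below is some other rule

OnlyWBelow : Below → Set
OnlyWBelow root = ⊤
OnlyWBelow (underW b _) = OnlyWBelow b
OnlyWBelow (under⇒R _ _) = ⊥
OnlyWBelow underO = ⊥

-- context (i): premise P = Θ,A,A,A,Γ, conclusion Q = Θ,A,A,Γ, followed by (W) to Θ,A,Γ
ContextI : Below → Ctx → Ctx → Set
ContextI (underW _ L) P Q =
  ∃[ Θ ] ∃[ A ] ∃[ Γ ] ((P ≡ Θ ++ A ∷ A ∷ A ∷ Γ) × (Q ≡ Θ ++ A ∷ A ∷ Γ) × (L ≡ Θ ++ A ∷ Γ))
ContextI _ _ _ = ⊥

-- context (ii): premise A,A,Γ, conclusion A,Γ, followed by (⇒R) to Γ ⊢ A → B
ContextII : Below → Ctx → Ctx → Set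
ContextII (under⇒R A Γ) P Q = (P ≡ A ∷ A ∷ Γ) × (Q ≡ A ∷ Γ)
ContextII _ _ _ = ⊥

WOk : Below → Ctx → Ctx → Set
WOk b P Q = OnlyWBelow b ⊎ ContextI b P Q ⊎ ContextII b P Q

WN : ∀ {Γ D} → Below → Γ ⊢ D → Set
WN b (ax _) = ⊤
WN b (ax⊥ _) = ⊤
WN b (C _ _ _ _ p) = WN underO p
WN b (W Θ A Γ p) = WOk b (Θ ++ A ∷ A ∷ Γ) (Θ ++ A ∷ Γ) × WN (underW b (Θ ++ A ∷ Γ)) p
WN b (K _ _ _ p) = WN underO p
WN b (cut _ _ _ _ p q) = WN underO p × WN underO q
WN b (∧L₁ _ _ _ _ p) = WN underO p
WN b (∧L₂ _ _ _ _ p) = WN underO p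
WN b (∧R _ _ _ p q) = WN underO p × WN underO q
WN b (∨L _ _ _ _ p q) = WN underO p × WN underO q
WN b (∨R₁ _ _ _ p) = WN underO p
WN b (∨R₂ _ _ _ p) = WN underO p
WN b (⇒L _ _ _ _ _ p q) = WN underO p × WN underO q
WN b (⇒R A Γ _ p) = WN (under⇒R A Γ) p

WNormal : ∀ {Γ D} → Γ ⊢ D → Set
WNormal p = WN root p

-- Contractions are postponed by keeping every copy they would identify. By induction on a
-- proof of Γ ⊢ D of degree d one builds a proof of degree at most d of Δ ⊢ D, where Δ
-- replaces each formula of Γ by a block of adjacent copies, and which contains (W) only in
-- chains contracting the discharged formula just before an (→R). A rule whose premise has k
-- copies of its principal formula is applied to each copy: for cut and (→L) this duplicates
-- the side context, whose copies are then regrouped by exchange; for (∨L) on n + m copies of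
-- A ∨ B, each of the 2ⁿ⁺ᵐ branches contains n copies of A or m copies of B and so follows
-- from a premise by weakening. Cut formulas are unchanged, so the degree does not grow. At
-- the end the blocks are contracted by (W)s placed below everything else, which W-normality
-- allows, and a dummy cut on a formula of size d restores the exact degree.

module Submission where

open import Defs
open import Data.Product using (Σ; _×_)
open import Relation.Binary.PropositionalEquality using (_≡_)

open import Data.Bool using (Bool; true; false)
open import Data.List using ([]; _∷_; _++_; [_]; replicate; concat)
open import Data.List.Properties using (++-assoc; ++-identityʳ)
open import Data.List.Relation.Binary.Permutation.Propositional
  using (_↭_; refl; prep; swap; ↭-sym; ↭-reflexive; module PermutationReasoning)
  renaming (trans to ↭-trans)
import Data.List.Relation.Binary.Permutation.Propositional.Properties as ↭
open import Algebra.Solver.CommutativeMonoid (↭.++-commutativeMonoid {A = Formula})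
  using (solve; _⊕_; _⊜_)
open import Data.Nat using (ℕ; zero; suc; _+_; _⊔_; _≤_; z≤n)
open import Data.Nat.Properties
  using (≤-trans; ≤-reflexive; m≤m⊔n; m≤n⊔m; ⊔-lub; n≤0⇒n≡0; m≥n⇒m⊔n≡m; +-suc; suc-injective)
open import Data.Product using (_,_; ∃-syntax; ∃₂)
open import Data.Sum using (inj₁; inj₂)
open import Data.Unit using (tt)
open import Data.Vec using (Vec; []; _∷_)
open import Relation.Binary.PropositionalEquality
  using (refl; sym; trans; cong; subst; module ≡-Reasoning)

replicate-+ : ∀ {a} {A : Set a} m n (x : A) → replicate (m + n) x ≡ replicate m x ++ replicate n x
replicate-+ zero    n x = refl
replicate-+ (suc m) n x = cong (x ∷_) (replicate-+ m n x)

-- W-normality of a subproof standing above a rule other than (W) and (→R): each of its (W)s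
-- belongs to a chain of (W)s ending in an (→R).
InnerWNormal : ∀ {Γ D} → Γ ⊢ D → Set
InnerWNormal = WN underO

InnerWNormal⇒WN : ∀ {Γ D} (p : Γ ⊢ D) → InnerWNormal p → ∀ b → WN b p
InnerWNormal⇒WN (ax _)              n b = n
InnerWNormal⇒WN (ax⊥ _)             n b = n
InnerWNormal⇒WN (C _ _ _ _ _)       n b = n
InnerWNormal⇒WN (W _ _ _ _)         (inj₁ () , _)
InnerWNormal⇒WN (W _ _ _ _)         (inj₂ (inj₁ ()) , _)
InnerWNormal⇒WN (W _ _ _ _)         (inj₂ (inj₂ ()) , _)
InnerWNormal⇒WN (K _ _ _ _)         n b = n
InnerWNormal⇒WN (cut _ _ _ _ _ _)   n b = n
InnerWNormal⇒WN (∧L₁ _ _ _ _ _)     n b = n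
InnerWNormal⇒WN (∧L₂ _ _ _ _ _)     n b = n
InnerWNormal⇒WN (∧R _ _ _ _ _)      n b = n
InnerWNormal⇒WN (∨L _ _ _ _ _ _)    n b = n
InnerWNormal⇒WN (∨R₁ _ _ _ _)       n b = n
InnerWNormal⇒WN (∨R₂ _ _ _ _)       n b = n
InnerWNormal⇒WN (⇒L _ _ _ _ _ _ _)  n b = n
InnerWNormal⇒WN (⇒R _ _ _ _)        n b = n

infix 3 _⊢[_]_

_⊢[_]_ : Ctx → ℕ → Formula → Set
Γ ⊢[ d ] D = Σ (Γ ⊢ D) λ p → InnerWNormal p × degree p ≤ d

⊢[]-mono : ∀ {d d′ Γ D} → d ≤ d′ → Γ ⊢[ d ] D → Γ ⊢[ d′ ] D
⊢[]-mono d≤d′ (p , n , l) = p , n , ≤-trans l d≤d′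

module _ {d : ℕ} {D : Formula} where

  exchange-under : ∀ Π {Γ Δ} → Γ ↭ Δ → Π ++ Γ ⊢[ d ] D → Π ++ Δ ⊢[ d ] D
  exchange-under-++ : ∀ Π Ξ {Γ Δ} → Γ ↭ Δ → Π ++ Ξ ++ Γ ⊢[ d ] D → Π ++ Ξ ++ Δ ⊢[ d ] D

  exchange-under Π refl          P            = P
  exchange-under Π (prep x ρ)    P            = exchange-under-++ Π [ x ] ρ P
  exchange-under Π (swap x y ρ)  (p , n , l)  =
    exchange-under-++ Π (y ∷ x ∷ []) ρ (C Π x y _ p , n , l)
  exchange-under Π (↭-trans ρ σ) P            = exchange-under Π σ (exchange-under Π ρ P)

  exchange-under-++ Π Ξ ρ P =
    subst (_⊢[ d ] D) (++-assoc Π Ξ _)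
      (exchange-under (Π ++ Ξ) ρ (subst (_⊢[ d ] D) (sym (++-assoc Π Ξ _)) P))

  exchange : ∀ {Γ Δ} → Γ ↭ Δ → Γ ⊢[ d ] D → Δ ⊢[ d ] D
  exchange = exchange-under []

  to-front : ∀ {A Γ} Π → Π ++ A ∷ Γ ⊢[ d ] D → A ∷ Π ++ Γ ⊢[ d ] D
  to-front Π = exchange (↭.shift _ Π _)

  from-front : ∀ {A Γ} Π → A ∷ Π ++ Γ ⊢[ d ] D → Π ++ A ∷ Γ ⊢[ d ] D
  from-front Π = exchange (↭-sym (↭.shift _ Π _))

  weaken : ∀ L {Γ} → Γ ⊢[ d ] D → L ++ Γ ⊢[ d ] D
  weaken []      P = P
  weaken (A ∷ L) P with weaken L P
  ... | p , n , l = K [] A _ p , n , l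

  weaken-under : ∀ Π {Γ Δ} L → Δ ↭ Γ ++ L → Π ++ Γ ⊢[ d ] D → Π ++ Δ ⊢[ d ] D
  weaken-under Π {Γ} {Δ} L ρ P = exchange σ (weaken L P)
    where
    σ : L ++ Π ++ Γ ↭ Π ++ Δ
    σ = ↭-trans (solve 3 (λ l π γ → l ⊕ (π ⊕ γ) ⊜ π ⊕ (γ ⊕ l)) refl L Π Γ) (↭.++⁺ˡ Π (↭-sym ρ))

module _ {d : ℕ} where

  cutᵈ : ∀ {Ξ A Γ D} → size A ≤ d → Ξ ⊢[ d ] A → A ∷ Γ ⊢[ d ] D → Ξ ++ Γ ⊢[ d ] D
  cutᵈ sA≤d (p , n , l) (q , m , k) = cut _ [] _ _ p q , (n , m) , ⊔-lub sA≤d (⊔-lub l k)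

  ⇒Lᵈ : ∀ {Ξ A B Γ D} → Ξ ⊢[ d ] A → B ∷ Γ ⊢[ d ] D → Ξ ++ (A ⇒ B) ∷ Γ ⊢[ d ] D
  ⇒Lᵈ (p , n , l) (q , m , k) = ⇒L _ [] _ _ _ p q , (n , m) , ⊔-lub l k

  ∨Lᵈ : ∀ {A B Γ D} → A ∷ Γ ⊢[ d ] D → B ∷ Γ ⊢[ d ] D → (A ∨ B) ∷ Γ ⊢[ d ] D
  ∨Lᵈ (p , n , l) (q , m , k) = ∨L [] _ _ _ p q , (n , m) , ⊔-lub l k

  ∧Rᵈ : ∀ {Γ A B} → Γ ⊢[ d ] A → Γ ⊢[ d ] B → Γ ⊢[ d ] A ∧ B
  ∧Rᵈ (p , n , l) (q , m , k) = ∧R _ _ _ p q , (n , m) , ⊔-lub l k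

  replace-all : ∀ {A D} Ξ → (∀ {Γ} → A ∷ Γ ⊢[ d ] D → Ξ ++ Γ ⊢[ d ] D) →
                ∀ n {Γ} → replicate n A ++ Γ ⊢[ d ] D → concat (replicate n Ξ) ++ Γ ⊢[ d ] D
  replace-all Ξ f zero    P = P
  replace-all {A} Ξ f (suc n) {Γ} P =
    subst (_⊢[ d ] _) (sym (++-assoc Ξ (concat (replicate n Ξ)) Γ))
      (f (to-front (concat (replicate n Ξ)) (replace-all Ξ f n (from-front (replicate n A) P))))

word : ∀ {n} → Formula → Formula → Vec Bool n → Ctx
word A B []          = []
word A B (true ∷ w)  = A ∷ word A B w
word A B (false ∷ w) = B ∷ word A B w

module _ {d : ℕ} {A B D : Formula} where

  ∨L-words : ∀ n {Γ} → (∀ (w : Vec Bool n) → word A B w ++ Γ ⊢[ d ] D) →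
             replicate n (A ∨ B) ++ Γ ⊢[ d ] D
  ∨L-words zero    h = h []
  ∨L-words (suc n) {Γ} h = ∨Lᵈ (branch A (λ w → h (true ∷ w))) (branch B (λ w → h (false ∷ w)))
    where
    branch : ∀ X → (∀ w → X ∷ word A B w ++ Γ ⊢[ d ] D) → X ∷ replicate n (A ∨ B) ++ Γ ⊢[ d ] D
    branch X hX = to-front (replicate n (A ∨ B)) (∨L-words n (λ w → from-front (word A B w) (hX w)))

  -- A word of length a + b contains a copies of A or b copies of B.
  word-⊢ : ∀ a b {n Γ} (w : Vec Bool n) → a + b ≡ n →
           replicate a A ++ Γ ⊢[ d ] D → replicate b B ++ Γ ⊢[ d ] D → word A B w ++ Γ ⊢[ d ] D
  word-⊢ zero    b       w e PA PB = weaken (word A B w) PA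
  word-⊢ (suc a) zero    w e PA PB = weaken (word A B w) PB
  word-⊢ (suc a) (suc b) (true ∷ w) e PA PB =
    to-front (word A B w)
      (word-⊢ a (suc b) w (suc-injective e)
        (from-front (replicate a A) PA) (from-front (replicate (suc b) B) (weaken [ A ] PB)))
  word-⊢ (suc a) (suc b) (false ∷ w) e PA PB =
    to-front (word A B w)
      (word-⊢ (suc a) b w (trans (sym (+-suc a b)) (suc-injective e))
        (from-front (replicate (suc a) A) (weaken [ B ] PA)) (from-front (replicate b B) PB))

  ∨L-copies : ∀ a b {Γ} → replicate a A ++ Γ ⊢[ d ] D → replicate b B ++ Γ ⊢[ d ] D →
              replicate (a + b) (A ∨ B) ++ Γ ⊢[ d ] D
  ∨L-copies a b PA PB = ∨L-words (a + b) (λ w → word-⊢ a b w refl PA PB)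

-- Blow-ups of contexts

-- Blowup Γ Δ: Δ arises from Γ by replacing each formula with a block of k + 1 adjacent copies.
data Blowup : Ctx → Ctx → Set where
  []  : Blowup [] []
  _∷_ : ∀ {A Γ Δ} k → Blowup Γ Δ → Blowup (A ∷ Γ) (replicate (suc k) A ++ Δ)

_++ᵇ_ : ∀ {Θ Θ′ Γ Γ′} → Blowup Θ Θ′ → Blowup Γ Γ′ → Blowup (Θ ++ Γ) (Θ′ ++ Γ′)
[] ++ᵇ c = c
_++ᵇ_ {A ∷ _} (k ∷ b) c =
  subst (Blowup _) (sym (++-assoc (replicate (suc k) A) _ _)) (k ∷ (b ++ᵇ c))

split : ∀ Θ {Γ Δ} → Blowup (Θ ++ Γ) Δ → ∃₂ λ Θ′ Γ′ → Blowup Θ Θ′ × Blowup Γ Γ′ × Δ ≡ Θ′ ++ Γ′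
split []      b       = [] , _ , [] , b , refl
split (A ∷ Θ) (k ∷ b) with split Θ b
... | Θ′ , Γ′ , bΘ , bΓ , refl = _ , Γ′ , k ∷ bΘ , bΓ , sym (++-assoc (replicate (suc k) A) Θ′ Γ′)

merge : ∀ {Γ Δ₁ Δ₂} → Blowup Γ Δ₁ → Blowup Γ Δ₂ → ∃[ Δ ] Blowup Γ Δ × Δ ↭ Δ₁ ++ Δ₂
merge []      []      = [] , [] , refl
merge (_∷_ {A} {Δ = Δ₁} k b) (_∷_ {Δ = Δ₂} l c) with merge b c
... | Δ , bc , ρ = _ , (k + suc l) ∷ bc , σ
  where
  open PermutationReasoning
  Aᵏ = replicate (suc k) A
  Aˡ = replicate (suc l) A
  σ : replicate (suc k + suc l) A ++ Δ ↭ (Aᵏ ++ Δ₁) ++ (Aˡ ++ Δ₂)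
  σ = begin
    replicate (suc k + suc l) A ++ Δ  ≡⟨ cong (_++ Δ) (replicate-+ (suc k) (suc l) A) ⟩
    (Aᵏ ++ Aˡ) ++ Δ                    ↭⟨ ↭.++⁺ˡ (Aᵏ ++ Aˡ) ρ ⟩
    (Aᵏ ++ Aˡ) ++ (Δ₁ ++ Δ₂)           ↭⟨ solve 4 (λ x y u v → (x ⊕ y) ⊕ (u ⊕ v) ⊜ (x ⊕ u) ⊕ (y ⊕ v))
                                                   refl Aᵏ Aˡ Δ₁ Δ₂ ⟩
    (Aᵏ ++ Δ₁) ++ (Aˡ ++ Δ₂)           ∎

merge-copies : ∀ {Γ Δ} → Blowup Γ Δ → ∀ n → ∃[ Δ′ ] Blowup Γ Δ′ × Δ′ ↭ concat (replicate (suc n) Δ)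
merge-copies {Δ = Δ} b zero = Δ , b , ↭-reflexive (sym (++-identityʳ Δ))
merge-copies {Δ = Δ} b (suc n) with merge-copies b n
... | Δ′ , b′ , ρ with merge b b′
... | Δ″ , b″ , σ = Δ″ , b″ , ↭-trans σ (↭.++⁺ˡ Δ ρ)

infix 3 _⊢⁺[_]_

_⊢⁺[_]_ : Ctx → ℕ → Formula → Set
Γ ⊢⁺[ d ] D = ∃[ Δ ] Blowup Γ Δ × Δ ⊢[ d ] D

⊢⁺[]-mono : ∀ {d d′ Γ D} → d ≤ d′ → Γ ⊢⁺[ d ] D → Γ ⊢⁺[ d′ ] D
⊢⁺[]-mono d≤d′ (Δ , b , P) = Δ , b , ⊢[]-mono d≤d′ P

⊢⁺[]-⊔ˡ : ∀ {m n Γ D} → Γ ⊢⁺[ m ] D → Γ ⊢⁺[ m ⊔ n ] D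
⊢⁺[]-⊔ˡ = ⊢⁺[]-mono (m≤m⊔n _ _)

⊢⁺[]-⊔ʳ : ∀ {m n Γ D} → Γ ⊢⁺[ n ] D → Γ ⊢⁺[ m ⊔ n ] D
⊢⁺[]-⊔ʳ = ⊢⁺[]-mono (m≤n⊔m _ _)

-- Simulating the rules on blow-ups

module _ {d : ℕ} {D : Formula} where

  C⁺ : ∀ Θ {A B Γ} → Θ ++ A ∷ B ∷ Γ ⊢⁺[ d ] D → Θ ++ B ∷ A ∷ Γ ⊢⁺[ d ] D
  C⁺ Θ {A} {B} (_ , b , P) with split Θ b
  ... | Θ′ , _ , bΘ , i ∷ j ∷ bΓ , refl =
    _ , bΘ ++ᵇ (j ∷ i ∷ bΓ) ,
    exchange (↭.++⁺ˡ Θ′ (↭.shifts (replicate (suc i) A) (replicate (suc j) B))) P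

  W⁺ : ∀ Θ {A Γ} → Θ ++ A ∷ A ∷ Γ ⊢⁺[ d ] D → Θ ++ A ∷ Γ ⊢⁺[ d ] D
  W⁺ Θ {A} (_ , b , P) with split Θ b
  ... | Θ′ , _ , bΘ , i ∷ _∷_ {Δ = Γ′} j bΓ , refl =
    _ , bΘ ++ᵇ ((i + suc j) ∷ bΓ) , subst (_⊢[ d ] D) (cong (Θ′ ++_) adjacent-blocks) P
    where
    open ≡-Reasoning
    Aⁱ = replicate (suc i) A
    Aʲ = replicate (suc j) A
    adjacent-blocks : Aⁱ ++ Aʲ ++ Γ′ ≡ replicate (suc i + suc j) A ++ Γ′
    adjacent-blocks = begin
      Aⁱ ++ Aʲ ++ Γ′                      ≡⟨ ++-assoc Aⁱ Aʲ Γ′ ⟨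
      (Aⁱ ++ Aʲ) ++ Γ′                    ≡⟨ cong (_++ Γ′) (replicate-+ (suc i) (suc j) A) ⟨
      replicate (suc i + suc j) A ++ Γ′   ∎

  K⁺ : ∀ Θ {A Γ} → Θ ++ Γ ⊢⁺[ d ] D → Θ ++ A ∷ Γ ⊢⁺[ d ] D
  K⁺ Θ {A} (_ , b , (p , n , l)) with split Θ b
  ... | Θ′ , Γ′ , bΘ , bΓ , refl = _ , bΘ ++ᵇ (0 ∷ bΓ) , K Θ′ A Γ′ p , n , l

  focus : ∀ Θ {A Γ} → Θ ++ A ∷ Γ ⊢⁺[ d ] D →
          ∃[ k ] ∃₂ λ Θ′ Γ′ → Blowup Θ Θ′ × Blowup Γ Γ′ × replicate (suc k) A ++ Θ′ ++ Γ′ ⊢[ d ] D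
  focus Θ {A} (_ , b , P) with split Θ b
  ... | Θ′ , _ , bΘ , _∷_ {Δ = Γ′} k bΓ , refl =
    k , Θ′ , Γ′ , bΘ , bΓ , exchange (↭.shifts Θ′ (replicate (suc k) A)) P

  left-rule⁺ : ∀ Θ {A Γ Ξ₀ Ξ} → Blowup Ξ₀ Ξ → (∀ {Γ′} → A ∷ Γ′ ⊢[ d ] D → Ξ ++ Γ′ ⊢[ d ] D) →
               Θ ++ A ∷ Γ ⊢⁺[ d ] D → Θ ++ Ξ₀ ++ Γ ⊢⁺[ d ] D
  left-rule⁺ Θ {Ξ = Ξ} bΞ f E with focus Θ E
  ... | k , Θ′ , Γ′ , bΘ , bΓ , P with merge-copies bΞ k
  ... | Ξ′ , bΞ′ , ρ = Θ′ ++ Ξ′ ++ Γ′ , bΘ ++ᵇ (bΞ′ ++ᵇ bΓ) , exchange σ (replace-all Ξ f (suc k) P)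
    where
    σ : concat (replicate (suc k) Ξ) ++ Θ′ ++ Γ′ ↭ Θ′ ++ Ξ′ ++ Γ′
    σ = ↭-trans (↭.shifts (concat (replicate (suc k) Ξ)) Θ′) (↭.++⁺ˡ Θ′ (↭.++⁺ʳ Γ′ (↭-sym ρ)))

  cut⁺ : ∀ {Ξ₀} Θ {A Γ} → size A ≤ d → Ξ₀ ⊢⁺[ d ] A → Θ ++ A ∷ Γ ⊢⁺[ d ] D → Θ ++ Ξ₀ ++ Γ ⊢⁺[ d ] D
  cut⁺ Θ sA≤d (_ , bΞ , P) = left-rule⁺ Θ bΞ (cutᵈ sA≤d P)

  ⇒L⁺ : ∀ {Ξ₀} Θ {A B Γ} → Ξ₀ ⊢⁺[ d ] A → Θ ++ B ∷ Γ ⊢⁺[ d ] D → Θ ++ Ξ₀ ++ (A ⇒ B) ∷ Γ ⊢⁺[ d ] D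
  ⇒L⁺ {Ξ₀} Θ {A} {B} {Γ} (Ξ , bΞ , P) E =
    subst (_⊢⁺[ d ] D) (cong (Θ ++_) (++-assoc Ξ₀ [ A ⇒ B ] Γ))
      (left-rule⁺ Θ (bΞ ++ᵇ (0 ∷ []))
        (λ Q → subst (_⊢[ d ] D) (sym (++-assoc Ξ [ A ⇒ B ] _)) (⇒Lᵈ P Q)) E)

  ∧L₁⁺ : ∀ Θ {A B Γ} → Θ ++ A ∷ Γ ⊢⁺[ d ] D → Θ ++ (A ∧ B) ∷ Γ ⊢⁺[ d ] D
  ∧L₁⁺ Θ {A} {B} = left-rule⁺ Θ (0 ∷ []) λ { (p , n , l) → ∧L₁ [] A B _ p , n , l }

  ∧L₂⁺ : ∀ Θ {A B Γ} → Θ ++ B ∷ Γ ⊢⁺[ d ] D → Θ ++ (A ∧ B) ∷ Γ ⊢⁺[ d ] D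
  ∧L₂⁺ Θ {A} {B} = left-rule⁺ Θ (0 ∷ []) λ { (p , n , l) → ∧L₂ [] A B _ p , n , l }

  ∨L⁺ : ∀ Θ {A B Γ} → Θ ++ A ∷ Γ ⊢⁺[ d ] D → Θ ++ B ∷ Γ ⊢⁺[ d ] D → Θ ++ (A ∨ B) ∷ Γ ⊢⁺[ d ] D
  ∨L⁺ Θ {A} {B} EA EB with focus Θ EA | focus Θ EB
  ... | i , Θ₁ , Γ₁ , bΘ₁ , bΓ₁ , PA | j , Θ₂ , Γ₂ , bΘ₂ , bΓ₂ , PB
      with merge (bΘ₁ ++ᵇ bΓ₁) (bΘ₂ ++ᵇ bΓ₂)
  ... | Δ , b , ρ with split Θ b
  ... | Θ₃ , Γ₃ , bΘ₃ , bΓ₃ , refl =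
    _ , bΘ₃ ++ᵇ ((i + suc j) ∷ bΓ₃) ,
    exchange (↭.shifts (replicate (suc i + suc j) (A ∨ B)) Θ₃)
      (∨L-copies (suc i) (suc j)
        (weaken-under (replicate (suc i) A) (Θ₂ ++ Γ₂) ρ PA)
        (weaken-under (replicate (suc j) B) (Θ₁ ++ Γ₁) (↭-trans ρ (↭.++-comm (Θ₁ ++ Γ₁) _)) PB))

module _ {d : ℕ} {Γ : Ctx} where

  ∧R⁺ : ∀ {A B} → Γ ⊢⁺[ d ] A → Γ ⊢⁺[ d ] B → Γ ⊢⁺[ d ] A ∧ B
  ∧R⁺ (Δ₁ , b₁ , P) (Δ₂ , b₂ , Q) with merge b₁ b₂
  ... | Δ , b , ρ =
    Δ , b , ∧Rᵈ (weaken-under [] Δ₂ ρ P) (weaken-under [] Δ₁ (↭-trans ρ (↭.++-comm Δ₁ Δ₂)) Q)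

  ∨R₁⁺ : ∀ {A B} → Γ ⊢⁺[ d ] A → Γ ⊢⁺[ d ] A ∨ B
  ∨R₁⁺ {A} {B} (Δ , b , (p , n , l)) = Δ , b , ∨R₁ Δ A B p , n , l

  ∨R₂⁺ : ∀ {A B} → Γ ⊢⁺[ d ] B → Γ ⊢⁺[ d ] A ∨ B
  ∨R₂⁺ {A} {B} (Δ , b , (p , n , l)) = Δ , b , ∨R₂ Δ A B p , n , l

⇒R-chain : Formula → Ctx → ℕ → Below
⇒R-chain A Γ zero    = under⇒R A Γ
⇒R-chain A Γ (suc k) = underW (⇒R-chain A Γ k) (A ∷ replicate k A ++ Γ)

⇒R-chain-WOk : ∀ A Γ k → WOk (⇒R-chain A Γ k) (A ∷ A ∷ replicate k A ++ Γ) (A ∷ replicate k A ++ Γ)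
⇒R-chain-WOk A Γ zero    = inj₂ (inj₂ (refl , refl))
⇒R-chain-WOk A Γ (suc k) = inj₂ (inj₁ ([] , A , replicate k A ++ Γ , refl , refl , refl))

contract-before-⇒R : ∀ {D} A Γ k (q : A ∷ replicate k A ++ Γ ⊢ D) → WN (⇒R-chain A Γ k) q →
                     Σ (A ∷ Γ ⊢ D) λ q′ → WN (under⇒R A Γ) q′ × degree q′ ≡ degree q
contract-before-⇒R A Γ zero    q w = q , w , refl
contract-before-⇒R A Γ (suc k) q w =
  contract-before-⇒R A Γ k (W [] A (replicate k A ++ Γ) q) (⇒R-chain-WOk A Γ k , w)

⇒R⁺ : ∀ {d A Γ B} → A ∷ Γ ⊢⁺[ d ] B → Γ ⊢⁺[ d ] A ⇒ B
⇒R⁺ {A = A} {B = B} (_ , _∷_ {Δ = Γ′} k b , q , n , l)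
  with contract-before-⇒R A Γ′ k q (InnerWNormal⇒WN q n _)
... | q′ , w , e = Γ′ , b , ⇒R A Γ′ B q′ , w , ≤-trans (≤-reflexive e) l

expand : ∀ {Γ D} (π : Γ ⊢ D) → Γ ⊢⁺[ degree π ] D
expand (ax A)                = _ , 0 ∷ [] , ax A , tt , z≤n
expand (ax⊥ A)               = _ , 0 ∷ [] , ax⊥ A , tt , z≤n
expand (C Θ _ _ _ p)         = C⁺ Θ (expand p)
expand (W Θ _ _ p)           = W⁺ Θ (expand p)
expand (K Θ _ _ p)           = K⁺ Θ (expand p)
expand (cut _ Θ A _ p q)     =
  cut⁺ Θ (m≤m⊔n _ _) (⊢⁺[]-⊔ʳ {size A} (⊢⁺[]-⊔ˡ {n = degree q} (expand p)))
                     (⊢⁺[]-⊔ʳ {size A} (⊢⁺[]-⊔ʳ {degree p} (expand q)))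
expand (∧L₁ Θ _ _ _ p)       = ∧L₁⁺ Θ (expand p)
expand (∧L₂ Θ _ _ _ p)       = ∧L₂⁺ Θ (expand p)
expand (∧R _ _ _ p q)        = ∧R⁺ (⊢⁺[]-⊔ˡ (expand p)) (⊢⁺[]-⊔ʳ (expand q))
expand (∨L Θ _ _ _ p q)      = ∨L⁺ Θ (⊢⁺[]-⊔ˡ (expand p)) (⊢⁺[]-⊔ʳ (expand q))
expand (∨R₁ _ _ _ p)         = ∨R₁⁺ (expand p)
expand (∨R₂ _ _ _ p)         = ∨R₂⁺ (expand p)
expand (⇒L _ Θ _ _ _ p q)    = ⇒L⁺ Θ (⊢⁺[]-⊔ˡ (expand p)) (⊢⁺[]-⊔ʳ (expand q))
expand (⇒R _ _ _ p)          = ⇒R⁺ (expand p)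

-- Exact degree and final contractions

⊥⇒ⁿ⊥ : ℕ → Formula
⊥⇒ⁿ⊥ zero    = ⊥̇
⊥⇒ⁿ⊥ (suc n) = ⊥̇ ⇒ ⊥⇒ⁿ⊥ n

size-⊥⇒ⁿ⊥ : ∀ n → size (⊥⇒ⁿ⊥ n) ≡ n
size-⊥⇒ⁿ⊥ zero    = refl
size-⊥⇒ⁿ⊥ (suc n) = cong suc (size-⊥⇒ⁿ⊥ n)

-- A proof of degree at most d is brought to degree exactly d by a dummy cut on ⊥⇒ⁿ⊥ d.
exact-degree : ∀ {d Γ D} → Γ ⊢[ d ] D → Σ (Γ ⊢ D) λ p → InnerWNormal p × degree p ≡ d
exact-degree {zero}      (p , n , l) = p , n , n≤0⇒n≡0 l
exact-degree {suc e} {Γ} (p , n , l) =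
  cut [] [] (⊥⇒ⁿ⊥ (suc e)) Γ (⇒R ⊥̇ [] _ (ax⊥ _)) (K [] _ Γ p) , (tt , n) ,
  trans (cong (_⊔ degree p) (size-⊥⇒ⁿ⊥ (suc e))) (m≥n⇒m⊔n≡m l)

WNormalAboveWs : ∀ {Γ D} → Γ ⊢ D → Set
WNormalAboveWs p = ∀ b → OnlyWBelow b → WN b p

NormalAboveWs : Ctx → Formula → ℕ → Set
NormalAboveWs Γ D d = Σ (Γ ⊢ D) λ p → WNormalAboveWs p × degree p ≡ d

contract-copies : ∀ {A Γ D d} Π k →
                  NormalAboveWs (Π ++ A ∷ replicate k A ++ Γ) D d → NormalAboveWs (Π ++ A ∷ Γ) D d
contract-copies Π zero    N           = N
contract-copies Π (suc k) (q , w , e) =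
  contract-copies Π k
    (W Π _ (replicate k _ ++ _) q , (λ b onlyW → inj₁ onlyW , w (underW b _) onlyW) , e)

contract : ∀ {Γ Δ D d} Π → Blowup Γ Δ → NormalAboveWs (Π ++ Δ) D d → NormalAboveWs (Π ++ Γ) D d
contract Π []            N = N
contract {D = D} {d} Π (_∷_ {A} k b) N =
  subst (λ Γ → NormalAboveWs Γ D d) (++-assoc Π [ A ] _)
    (contract (Π ++ [ A ]) b
      (subst (λ Γ → NormalAboveWs Γ D d) (sym (++-assoc Π [ A ] _)) (contract-copies Π k N)))

theorem5p5 : ∀ {Γ D} (π : Γ ⊢ D) → Σ (Γ ⊢ D) (λ π′ → WNormal π′ × degree π′ ≡ degree π)
theorem5p5 π with expand π
... | _ , blowup , P with exact-degree P
... | p , n , e with contract [] blowup (p , (λ b _ → InnerWNormal⇒WN p n b) , e)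
... | π′ , w , e′ = π′ , w root tt , e′
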